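{- Let $\Gamma$ be a commutative thick weakly distance-regular digraph. If $\Gamma_{1,p-1}\in\Gamma_{1,q-1}\Gamma_{q-1,1}$, then $\Gamma_{1,p-1}^{2}\subseteq\Gamma_{1,q-1}\Gamma_{q-1,1}$.
   Context: All digraphs are finite, simple, strongly connected. $\partial(x,y)$ is the directed distance, $\tilde\partial(x,y)=(\partial(x,y),\partial(y,x))$, $\tilde\partial(\Gamma)$ the set of all such pairs; $\Gamma_{a,b}=\{(x,y)\mid\tilde\partial(x,y)=(a,b)\}$, $\Gamma_{a,b}(x)=\{y\mid(x,y)\in\Gamma_{a,b}\}$. Weakly distance-regular: for $\tilde h,\tilde i,\tilde j\in\tilde\partial(\Gamma)$, the number $p^{\tilde h}_{\tilde i,\tilde j}$ of $z$ with $\tilde\partial(x,z)=\tilde i,\tilde\partial(z,y)=\tilde j$ depends only on $\tilde h=\tilde\partial(x,y)$; commutative: $p^{\tilde h}_{\tilde i,\tilde j}=p^{\tilde h}_{\tilde j,\tilde i}$; $k_{\tilde i}=|\Gamma_{\tilde i}(x)|$; thick: $p^{\tilde h}_{\tilde i,\tilde i},p^{\tilde h}_{\tilde i,\tilde i^*}\in\{0,k_{\tilde i}\}$ with $(a,b)^*=(b,a)$. With $R=\{\Gamma_{\tilde i}\mid\tilde i\in\tilde\partial(\Gamma)\}$ and nonempty $E,F\subseteq R$, $EF=\{\Gamma_{\tilde h}\mid\sum_{\Gamma_{\tilde i}\in E}\sum_{\Gamma_{\tilde j}\in F}p^{\tilde h}_{\tilde i,\tilde j}\neq0\}$; a single relation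 is identified with its singleton, and $\Gamma_{\tilde i}^2=\Gamma_{\tilde i}\Gamma_{\tilde i}$. -}

module Defs where

open import Data.Nat using (ℕ; zero; suc; _∸_)
open import Data.Nat.Properties using () renaming (_≟_ to _≟ℕ_)
open import Data.Fin using (Fin) renaming (_≟_ to _≟F_)
open import Data.Bool using (Bool; true; false; if_then_else_; _∧_)
open import Data.List using (List; filter; length)
open import Data.Bool.ListAction using (any)
open import Data.List.Base using (allFin)
open import Data.Product using (_×_; _,_; ∃; ∃-syntax; swap)
open import Data.Product.Properties using (≡-dec)
open import Data.Sum using (_⊎_)
open import Relation.Nullary using (does; ¬_; _×-dec_)
open import Relation.Binary.PropositionalEquality using (_≡_; _≢_)

record Digraph : Set where
  field
    n        : ℕ
    arc      : Fin n → Fin n → Bool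
    loopless : ∀ x → arc x x ≡ false
open Digraph public

module _ (Γ : Digraph) where
  private V = Fin (n Γ)

  walk : ℕ → V → V → Bool
  walk zero    x y = does (x ≟F y)
  walk (suc k) x y = any (λ z → arc Γ x z ∧ walk k z y) (allFin (n Γ))

  StronglyConnected : Set
  StronglyConnected = ∀ x y → ∃[ d ] walk d x y ≡ true

  -- least d < fuel with f d = true (returns fuel if there is none)
  firstTrue : (ℕ → Bool) → ℕ → ℕ
  firstTrue f zero    = zero
  firstTrue f (suc m) = if f 0 then 0 else suc (firstTrue (λ d → f (suc d)) m)

  -- directed distance ∂(x,y): length of a shortest directed walk from x to y
  -- (shortest walks are paths, so have length < n in a strongly connected digraph)
  ∂ : V → V → ℕ
  ∂ x y = firstTrue (λ d → walk d x y) (n Γ)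

  ∂̃ : V → V → ℕ × ℕ
  ∂̃ x y = (∂ x y , ∂ y x)

  _≟P_ : (a b : ℕ × ℕ) → _
  _≟P_ = ≡-dec _≟ℕ_ _≟ℕ_

  p : V → V → ℕ × ℕ → ℕ × ℕ → ℕ
  p x y i j = length (filter (λ z → (∂̃ x z ≟P i) ×-dec (∂̃ z y ≟P j)) (allFin (n Γ)))

  kk : V → ℕ × ℕ → ℕ
  kk x i = length (filter (λ z → ∂̃ x z ≟P i) (allFin (n Γ)))

  WeaklyDistanceRegular : Set
  WeaklyDistanceRegular = ∀ x y x' y' i j → ∂̃ x y ≡ ∂̃ x' y' → p x y i j ≡ p x' y' i j

  Commutative : Set
  Commutative = ∀ x y i j → p x y i j ≡ p x y j i

  Thick : Set
  Thick = ∀ x y i →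
    (p x y i i ≡ 0 ⊎ p x y i i ≡ kk x i) ×
    (p x y i (swap i) ≡ 0 ⊎ p x y i (swap i) ≡ kk x i)

  -- Γ_h ∈ Γ_i Γ_j : Γ_h is a (nonempty) relation of Γ and p^h_{i,j} ≠ 0
  _∈_·_ : ℕ × ℕ → ℕ × ℕ → ℕ × ℕ → Set
  h ∈ i · j = ∃[ x ] ∃[ y ] (∂̃ x y ≡ h × p x y i j ≢ 0)

  _·_⊆_·_ : ℕ × ℕ → ℕ × ℕ → ℕ × ℕ → ℕ × ℕ → Set
  i · j ⊆ k · l = ∀ h → h ∈ i · j → h ∈ k · l

module Submission where

-- Take x, y with ∂̃(x,y) = h and a vertex z with ∂̃(x,z) = ∂̃(z,y) = j. Since
-- p^j_{i,i*} ≠ 0, there is w with ∂̃(x,w) = i and ∂̃(w,z) = i*, i.e. w ∈ Γ_i(z).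
-- Thickness upgrades p^j_{i,i*} ≠ 0 to p^j_{i,i*} = k_i, so every vertex of
-- Γ_i(z), in particular w, satisfies ∂̃(w,y) = i*; hence p^h_{i,i*} ≠ 0.

open import Defs
open import Data.Nat using (ℕ; _∸_)
open import Data.Fin using (Fin)
open import Data.Nat.Properties using (n>0⇒n≢0)
open import Data.Product using (_,_; _×_; ∃-syntax; proj₂; swap)
open import Data.Sum using (inj₁; inj₂)
open import Data.List using ([]; _∷_; filter; length; allFin)
open import Data.List.Properties using (filter-some)
open import Data.List.Membership.Propositional using (_∈_; lose)
open import Data.List.Membership.Propositional.Properties
  using (∈-filter⁺; ∈-filter⁻; ∈-allFin)
open import Data.List.Relation.Unary.Any using (here)
open import Data.List.Relation.Binary.Equality.Propositional using (≋⇒≡)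
open import Data.List.Relation.Binary.Sublist.Propositional using (⊆-refl)
open import Data.List.Relation.Binary.Sublist.Propositional.Properties
  using (filter⁺; to-≋)
open import Data.Empty using (⊥-elim)
open import Relation.Nullary using (_×-dec_)
open import Relation.Unary using (Decidable)
open import Relation.Binary.PropositionalEquality
  using (_≡_; _≢_; refl; sym; trans; subst; cong)

module _ {A : Set} {P : A → Set} (P? : Decidable P) where

  length-filter≢0⇒∃ : ∀ xs → length (filter P? xs) ≢ 0 → ∃[ a ] P a
  length-filter≢0⇒∃ xs ne with filter P? xs in eq
  ... | []    = ⊥-elim (ne refl)
  ... | a ∷ _ = a , proj₂ (∈-filter⁻ P? {xs = xs} (subst (a ∈_) (sym eq) (here refl)))

  ∈⇒length-filter≢0 : ∀ {xs a} → a ∈ xs → P a → length (filter P? xs) ≢ 0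
  ∈⇒length-filter≢0 a∈xs Pa = n>0⇒n≢0 (filter-some P? (lose a∈xs Pa))

-- Filtering by P is a sublist of filtering by the weaker Q; equal lengths
-- force the two sublists to coincide.
length-filter-≡⇒⊇ : {A : Set} {P Q : A → Set} (P? : Decidable P) (Q? : Decidable Q) →
  (∀ {a} → P a → Q a) → ∀ xs → length (filter P? xs) ≡ length (filter Q? xs) →
  ∀ {a} → a ∈ xs → Q a → P a
length-filter-≡⇒⊇ P? Q? P⇒Q xs eq a∈xs Qa =
  proj₂ (∈-filter⁻ P? {xs = xs} (subst (_ ∈_) (sym filters-equal) (∈-filter⁺ Q? a∈xs Qa)))
  where
  filters-equal : filter P? xs ≡ filter Q? xs
  filters-equal = ≋⇒≡ (to-≋ eq (filter⁺ P? Q? (λ { refl → P⇒Q }) (⊆-refl {x = xs})))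

module _ (Γ : Digraph) where

  private
    intermediate? : (x y : Fin (n Γ)) (i j : ℕ × ℕ) → Decidable (λ z → ∂̃ Γ x z ≡ i × ∂̃ Γ z y ≡ j)
    intermediate? x y i j z = (_≟P_ Γ (∂̃ Γ x z) i) ×-dec (_≟P_ Γ (∂̃ Γ z y) j)

  p≢0⇒∃-intermediate : ∀ {x y i j} → p Γ x y i j ≢ 0 →
    ∃[ z ] ∂̃ Γ x z ≡ i × ∂̃ Γ z y ≡ j
  p≢0⇒∃-intermediate {x} {y} {i} {j} =
    length-filter≢0⇒∃ (intermediate? x y i j) (allFin (n Γ))

  ∃-intermediate⇒p≢0 : ∀ {x y z i j} → ∂̃ Γ x z ≡ i → ∂̃ Γ z y ≡ j → p Γ x y i j ≢ 0
  ∃-intermediate⇒p≢0 {x} {y} {z} {i} {j} xz zy =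
    ∈⇒length-filter≢0 (intermediate? x y i j) (∈-allFin z) (xz , zy)

  ∈·⇒p≢0 : WeaklyDistanceRegular Γ → ∀ {h i j x y} →
    _∈_·_ Γ h i j → ∂̃ Γ x y ≡ h → p Γ x y i j ≢ 0
  ∈·⇒p≢0 wdr {x = x} {y} (x₀ , y₀ , x₀y₀ , p≢0) xy p≡0 =
    p≢0 (trans (wdr x₀ y₀ x y _ _ (trans x₀y₀ (sym xy))) p≡0)

  thick-p≢0⇒∀-intermediate : Thick Γ → ∀ {x y i} → p Γ x y i (swap i) ≢ 0 →
    ∀ {w} → ∂̃ Γ x w ≡ i → ∂̃ Γ w y ≡ swap i
  thick-p≢0⇒∀-intermediate thick {x} {y} {i} p≢0 {w} xw with proj₂ (thick x y i)
  ... | inj₁ p≡0  = ⊥-elim (p≢0 p≡0)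
  ... | inj₂ p≡kk = proj₂ (length-filter-≡⇒⊇ (intermediate? x y i (swap i))
                      (λ z → _≟P_ Γ (∂̃ Γ x z) i) (λ { (xz , _) → xz })
                      (allFin (n Γ)) p≡kk (∈-allFin w) xw)

  ∈·swap⇒square⊆ : WeaklyDistanceRegular Γ → Thick Γ → ∀ {i j} →
    _∈_·_ Γ j i (swap i) → _·_⊆_·_ Γ j j i (swap i)
  ∈·swap⇒square⊆ wdr thick {i} j∈ii* h (x , y , xy , p≢0)
    with z , xz , zy ← p≢0⇒∃-intermediate p≢0
    with w , xw , wz ← p≢0⇒∃-intermediate (∈·⇒p≢0 wdr j∈ii* xz)
    = x , y , xy , ∃-intermediate⇒p≢0 xw wy
    where
    wy : ∂̃ Γ w y ≡ swap i
    wy = thick-p≢0⇒∀-intermediate thick (∈·⇒p≢0 wdr j∈ii* zy) (cong swap wz)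

lemma2p2 : (Γ : Digraph) → StronglyConnected Γ → WeaklyDistanceRegular Γ →
    Commutative Γ → Thick Γ → (p q : ℕ) →
    _∈_·_ Γ (1 , p ∸ 1) (1 , q ∸ 1) (q ∸ 1 , 1) →
    _·_⊆_·_ Γ (1 , p ∸ 1) (1 , p ∸ 1) (1 , q ∸ 1) (q ∸ 1 , 1)
lemma2p2 Γ _ wdr _ thick _ _ = ∈·swap⇒square⊆ Γ wdr thick
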